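{- Let $S=S_1\mathtt t\mathtt d S_2$ be a feasible strategy for configuration $(a,p)$. If $S'=S_1\mathtt d\mathtt t S_2$ is also feasible, then $E_{a,p}[S]\ge E_{a,p}[S']$.
   Context: Setting: uniform decremental sets played by UniRand (which at each step collects a uniformly random pending item if one exists). A configuration $(a,p)$ means $a$ active items of which $p$ are pending for UniRand, the pending set being a uniformly random $p$-subset of the active items. An adversary strategy is a word in $\{\mathtt t,\mathtt d\}^*$: $\mathtt t$ = the adversary collects an item and UniRand collects a uniformly random pending item if it has one; $\mathtt d$ = one active item is deleted. A strategy is feasible for $(a,p)$ if it contains exactly $a$ letters $\mathtt d$ and every suffix contains no more $\mathtt t$'s than $\mathtt d$'s. $E_{a,p}[S]$ is the expected number of items collected by UniRand starting from $(a,p)$ against $S$; equivalently $E_{a,p}[\varepsilon]=0$, $E_{a,p}[\mathtt t S']=1+E_{a,p-1}[S']$ if $p\ge1$, $E_{a,0}[\mathtt t S']=E_{a,0}[S']$, and $E_{a,p}[\mathtt d S']=\frac{a-p}{a}E_{a-1,p}[S']+\frac{p}{a}E_{a-1,p-1}[S']$. -}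

module Defs where

open import Data.Nat using (ℕ; zero; suc; _∸_; _≤_)
open import Data.Integer using (+_)
open import Data.Rational using (ℚ; _/_; _+_; _*_; 0ℚ; 1ℚ)
open import Data.List using (List; []; _∷_; drop)
open import Data.Product using (_×_)
open import Relation.Binary.PropositionalEquality using (_≡_)

-- Adversary moves: t = adversary collects (UniRand collects a random pending item),
-- d = one active item is deleted.
data Letter : Set where
  t d : Letter

Strategy : Set
Strategy = List Letter

countT : Strategy → ℕ
countT [] = 0
countT (t ∷ s) = suc (countT s)
countT (d ∷ s) = countT s

countD : Strategy → ℕ
countD [] = 0
countD (t ∷ s) = countD s
countD (d ∷ s) = suc (countD s)

Feasible : ℕ → Strategy → Set
Feasible a S = (countD S ≡ a) × (∀ k → countT (drop k S) ≤ countD (drop k S))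

-- Expected number of items collected by UniRand from configuration (a,p) against S.
-- The case a = 0 with a letter d never arises for feasible strategies; it is set to 0.
E : ℕ → ℕ → Strategy → ℚ
E a p [] = 0ℚ
E a zero (t ∷ s) = E a zero s
E a (suc p) (t ∷ s) = 1ℚ + E a p s
E zero p (d ∷ s) = 0ℚ
E (suc a) p (d ∷ s) =
  ((+ (suc a ∸ p)) / suc a) * E a p s + ((+ p) / suc a) * E a (p ∸ 1) s

-- First, E a p S is nondecreasing in the number p of pending items
-- (p < a): splitting the weight (a + 1 − p)/(a + 1) of a deletion as 1/(a + 1) + (a − p)/(a + 1)
-- pairs each term of the expansion at p with a term at p + 1 having one more pending item, by
-- induction.  Second, the local swap d t ≤ t d: after unfolding one step on each side the weights
-- (a − q)/(a + 1) and (q + 1)/(a + 1) add up to 1, and what remains is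
-- (E a q S − E a (q − 1) S)/(a + 1) ≥ 0 by the first fact.  Finally E a p (S₁ ++ X) is a monotone
-- function of the values E a' p' X with p' ≤ a', since each letter either adds a constant or takes
-- a nonnegative combination, so the swap survives any prefix.
module Submission where

open import Defs
open import Data.Nat as ℕ using (ℕ; zero; suc; _∸_; _≤_; _<_; s≤s)
import Data.Nat.Properties as ℕ
open import Data.Integer as ℤ using (+_)
import Data.Integer.Properties as ℤ
import Data.Integer.Solver as ℤ-Solver
open import Data.Rational using (ℚ; _/_; _+_; _*_; 0ℚ; 1ℚ; NonNegative; fromℚᵘ; toℚᵘ)
  renaming (_≤_ to _≤ℚ_)
open import Data.Rational.Properties
import Data.Rational.Solver as ℚ-Solver
open import Data.Rational.Unnormalised as ℚᵘ using (mkℚᵘ; _≃_; *≡*)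
import Data.Rational.Unnormalised.Properties as ℚᵘ
open import Data.List using (_∷_; []; _++_)
open import Relation.Nullary using (yes; no)
open import Relation.Binary.PropositionalEquality

fromℚᵘ-homo-+ : ∀ p q → fromℚᵘ (p ℚᵘ.+ q) ≡ fromℚᵘ p + fromℚᵘ q
fromℚᵘ-homo-+ p q = toℚᵘ-injective (begin
  toℚᵘ (fromℚᵘ (p ℚᵘ.+ q))              ≈⟨ toℚᵘ-fromℚᵘ (p ℚᵘ.+ q) ⟩
  p ℚᵘ.+ q                              ≈⟨ ℚᵘ.+-cong (toℚᵘ-fromℚᵘ p) (toℚᵘ-fromℚᵘ q) ⟨
  toℚᵘ (fromℚᵘ p) ℚᵘ.+ toℚᵘ (fromℚᵘ q)  ≈⟨ toℚᵘ-homo-+ (fromℚᵘ p) (fromℚᵘ q) ⟨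
  toℚᵘ (fromℚᵘ p + fromℚᵘ q)            ∎)
  where open ℚᵘ.≃-Reasoning

mkℚᵘ-+ : ∀ i j n → mkℚᵘ (i ℤ.+ j) n ≃ mkℚᵘ i n ℚᵘ.+ mkℚᵘ j n
mkℚᵘ-+ i j n = *≡* (begin
  (i ℤ.+ j) ℤ.* + (suc n ℕ.* suc n)            ≡⟨ cong ((i ℤ.+ j) ℤ.*_) (ℤ.pos-* (suc n) (suc n)) ⟩
  (i ℤ.+ j) ℤ.* (+ suc n ℤ.* + suc n)
    ≡⟨ solve 3 (λ i j m → (i :+ j) :* (m :* m) := (i :* m :+ j :* m) :* m) refl i j (+ suc n) ⟩
  (i ℤ.* + suc n ℤ.+ j ℤ.* + suc n) ℤ.* + suc n ∎)
  where open ≡-Reasoning; open ℤ-Solver.+-*-Solver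

-- Opaque so that the gcd normalisation hidden in _/_ is never unfolded during unification.
opaque
  ratio : ℕ → ℕ → ℚ
  ratio k n = + k / suc n

  ratio-nonNeg : ∀ k n → NonNegative (ratio k n)
  ratio-nonNeg k n = normalize-nonNeg k (suc n)

  ratio-zero : ∀ n → ratio 0 n ≡ 0ℚ
  ratio-zero n = 0/n≡0 (suc n)

  ratio-self : ∀ n → ratio (suc n) n ≡ 1ℚ
  ratio-self n = fromℚᵘ-cong {mkℚᵘ (+ suc n) n} {ℚᵘ.1ℚᵘ} (*≡* (ℤ.*-comm (+ suc n) (+ 1)))

  ratio-+ : ∀ i j n → ratio (i ℕ.+ j) n ≡ ratio i n + ratio j n
  ratio-+ i j n = begin
    fromℚᵘ (mkℚᵘ (+ (i ℕ.+ j)) n)                ≡⟨ cong (λ k → fromℚᵘ (mkℚᵘ k n)) (ℤ.pos-+ i j) ⟩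
    fromℚᵘ (mkℚᵘ (+ i ℤ.+ + j) n)                ≡⟨ fromℚᵘ-cong (mkℚᵘ-+ (+ i) (+ j) n) ⟩
    fromℚᵘ (mkℚᵘ (+ i) n ℚᵘ.+ mkℚᵘ (+ j) n)      ≡⟨ fromℚᵘ-homo-+ (mkℚᵘ (+ i) n) (mkℚᵘ (+ j) n) ⟩
    fromℚᵘ (mkℚᵘ (+ i) n) + fromℚᵘ (mkℚᵘ (+ j) n) ∎
    where open ≡-Reasoning

deletion : ℕ → ℕ → (ℕ → ℚ) → ℚ
deletion a p f = ratio (suc a ∸ p) a * f p + ratio p a * f (p ∸ 1)

opaque
  unfolding ratio

  E-d : ∀ a p s → E (suc a) p (d ∷ s) ≡ deletion a p (λ q → E a q s)
  E-d a zero    s = refl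
  E-d a (suc p) s = refl

*-monoˡ-≤-ratio : ∀ k n {x y} → x ≤ℚ y → ratio k n * x ≤ℚ ratio k n * y
*-monoˡ-≤-ratio k n = *-monoˡ-≤-nonNeg (ratio k n) {{ratio-nonNeg k n}}

-- For q ≥ m the weight is ratio 0 n = 0, so the comparison is only needed below m.
*-monoˡ-≤-ratio∸ : ∀ m q n {x y} → (q < m → x ≤ℚ y) → ratio (m ∸ q) n * x ≤ℚ ratio (m ∸ q) n * y
*-monoˡ-≤-ratio∸ m q n {x} {y} x≤y with q ℕ.<? m
... | yes q<m = *-monoˡ-≤-ratio (m ∸ q) n (x≤y q<m)
... | no  q≮m rewrite ℕ.m≤n⇒m∸n≡0 (ℕ.≮⇒≥ q≮m) | ratio-zero n | *-zeroˡ x | *-zeroˡ y = ≤-refl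

ratio-suc∸ : ∀ {a q} → q ≤ a → ratio (suc a ∸ q) a ≡ ratio 1 a + ratio (a ∸ q) a
ratio-suc∸ {a} {q} q≤a = trans (cong (λ k → ratio k a) (ℕ.+-∸-assoc 1 q≤a)) (ratio-+ 1 (a ∸ q) a)

ratio-∸+suc : ∀ {a q} → q ≤ a → ratio (a ∸ q) a + ratio (suc q) a ≡ 1ℚ
ratio-∸+suc {a} {q} q≤a = begin
  ratio (a ∸ q) a + ratio (suc q) a ≡⟨ ratio-+ (a ∸ q) (suc q) a ⟨
  ratio (a ∸ q ℕ.+ suc q) a         ≡⟨ cong (λ k → ratio k a) (ℕ.+-suc (a ∸ q) q) ⟩
  ratio (suc (a ∸ q ℕ.+ q)) a       ≡⟨ cong (λ k → ratio (suc k) a) (ℕ.m∸n+n≡m q≤a) ⟩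
  ratio (suc a) a                   ≡⟨ ratio-self a ⟩
  1ℚ                                ∎
  where open ≡-Reasoning

x≤1+x : ∀ x → x ≤ℚ 1ℚ + x
x≤1+x x = subst (_≤ℚ 1ℚ + x) (+-identityˡ x) (+-monoˡ-≤ x (nonNegative⁻¹ 1ℚ))

MonotoneBelow : ℕ → (ℕ → ℚ) → Set
MonotoneBelow a f = ∀ q → q < a → f q ≤ℚ f (suc q)

MonotoneBelow-pred : ∀ {a f} → MonotoneBelow a f → ∀ q → q ≤ a → f (q ∸ 1) ≤ℚ f q
MonotoneBelow-pred mono zero    _   = ≤-refl
MonotoneBelow-pred mono (suc q) q<a = mono q q<a

deletion-mono : ∀ a p {f g} → (∀ q → q ≤ a → f q ≤ℚ g q) → p ≤ suc a →
                deletion a p f ≤ℚ deletion a p g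
deletion-mono a p f≤g p≤1+a = +-mono-≤
  (*-monoˡ-≤-ratio∸ (suc a) p a (λ p<1+a → f≤g p (ℕ.≤-pred p<1+a)))
  (*-monoˡ-≤-ratio p a (f≤g (p ∸ 1) (ℕ.∸-monoˡ-≤ 1 p≤1+a)))

deletion-monotone : ∀ a q {f} → MonotoneBelow a f → q ≤ a → deletion a q f ≤ℚ deletion a (suc q) f
deletion-monotone a q {f} mono q≤a = begin
  ratio (suc a ∸ q) a * f q + z * f (q ∸ 1)
    ≡⟨ cong (λ r → r * f q + z * f (q ∸ 1)) (ratio-suc∸ q≤a) ⟩
  (y + x) * f q + z * f (q ∸ 1)
    ≡⟨ solve 5 (λ x y z u v → (y :+ x) :* u :+ z :* v := x :* u :+ (y :* u :+ z :* v))
               refl x y z (f q) (f (q ∸ 1)) ⟩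
  x * f q + (y * f q + z * f (q ∸ 1))
    ≤⟨ +-mono-≤ (*-monoˡ-≤-ratio∸ a q a (mono q))
                (+-monoʳ-≤ (y * f q) (*-monoˡ-≤-ratio q a (MonotoneBelow-pred mono q q≤a))) ⟩
  x * f (suc q) + (y * f q + z * f q)
    ≡⟨ cong (_+_ (x * f (suc q))) (*-distribʳ-+ (f q) y z) ⟨
  x * f (suc q) + (y + z) * f q
    ≡⟨ cong (λ r → x * f (suc q) + r * f q) (ratio-+ 1 q a) ⟨
  x * f (suc q) + ratio (suc q) a * f q
    ∎
  where
  open ≤-Reasoning
  open ℚ-Solver.+-*-Solver
  x = ratio (a ∸ q) a
  y = ratio 1 a
  z = ratio q a

E-monotone-pending : ∀ a S → MonotoneBelow a (λ q → E a q S)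
E-monotone-pending a       []      q       _          = ≤-refl
E-monotone-pending a       (t ∷ s) zero    _          = x≤1+x (E a 0 s)
E-monotone-pending a       (t ∷ s) (suc q) 1+q<a      = +-monoʳ-≤ 1ℚ (E-monotone-pending a s q (ℕ.<⇒≤ 1+q<a))
E-monotone-pending (suc a) (d ∷ s) q       (s≤s q≤a)
  rewrite E-d a q s | E-d a (suc q) s = deletion-monotone a q (E-monotone-pending a s) q≤a

E-t≤1+E-pred : ∀ a q s → E a q (t ∷ s) ≤ℚ 1ℚ + E a (q ∸ 1) s
E-t≤1+E-pred a zero    s = x≤1+x (E a 0 s)
E-t≤1+E-pred a (suc q) s = ≤-refl

_≼_ : Strategy → Strategy → Set
X ≼ Y = ∀ {a p} → p ≤ a → E a p X ≤ℚ E a p Y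

dt≼td : ∀ S → (d ∷ t ∷ S) ≼ (t ∷ d ∷ S)
dt≼td S {zero}  {zero}  _         = ≤-refl
dt≼td S {suc a} {zero}  _         = ≤-reflexive (trans (E-d a 0 (t ∷ S)) (sym (E-d a 0 S)))
dt≼td S {suc a} {suc q} (s≤s q≤a) = begin
  E (suc a) (suc q) (d ∷ t ∷ S)
    ≡⟨ E-d a (suc q) (t ∷ S) ⟩
  x * (1ℚ + u) + w * E a q (t ∷ S)
    ≤⟨ +-monoʳ-≤ (x * (1ℚ + u)) (*-monoˡ-≤-ratio (suc q) a (E-t≤1+E-pred a q S)) ⟩
  x * (1ℚ + u) + w * (1ℚ + v)
    ≡⟨ solve 4 (λ x w u v → x :* (con 1ℚ :+ u) :+ w :* (con 1ℚ :+ v)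
                          := (x :+ w) :+ (x :* u :+ w :* v)) refl x w u v ⟩
  (x + w) + (x * u + w * v)
    ≡⟨ cong₂ (λ c r → c + (x * u + r * v)) (ratio-∸+suc q≤a) (ratio-+ 1 q a) ⟩
  1ℚ + (x * u + (y + z) * v)
    ≡⟨ solve 5 (λ x y z u v → con 1ℚ :+ (x :* u :+ (y :+ z) :* v)
                            := con 1ℚ :+ (y :* v :+ (x :* u :+ z :* v))) refl x y z u v ⟩
  1ℚ + (y * v + (x * u + z * v))
    ≤⟨ +-monoʳ-≤ 1ℚ (+-monoˡ-≤ (x * u + z * v) (*-monoˡ-≤-ratio 1 a v≤u)) ⟩
  1ℚ + (y * u + (x * u + z * v))
    ≡⟨ solve 5 (λ x y z u v → con 1ℚ :+ (y :* u :+ (x :* u :+ z :* v))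
                            := con 1ℚ :+ ((y :+ x) :* u :+ z :* v)) refl x y z u v ⟩
  1ℚ + ((y + x) * u + z * v)
    ≡⟨ cong (λ r → 1ℚ + (r * u + z * v)) (ratio-suc∸ q≤a) ⟨
  1ℚ + deletion a q (λ r → E a r S)
    ≡⟨ cong (_+_ 1ℚ) (E-d a q S) ⟨
  E (suc a) (suc q) (t ∷ d ∷ S)
    ∎
  where
  open ≤-Reasoning
  open ℚ-Solver.+-*-Solver
  x = ratio (a ∸ q) a
  w = ratio (suc q) a
  y = ratio 1 a
  z = ratio q a
  u = E a q S
  v = E a (q ∸ 1) S
  v≤u : v ≤ℚ u
  v≤u = MonotoneBelow-pred (E-monotone-pending a S) q q≤a

++⁺-≼ : ∀ S {X Y} → X ≼ Y → (S ++ X) ≼ (S ++ Y)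
++⁺-≼ []      X≼Y                 p≤a   = X≼Y p≤a
++⁺-≼ (t ∷ S) X≼Y {a}     {zero}  p≤a   = ++⁺-≼ S X≼Y p≤a
++⁺-≼ (t ∷ S) X≼Y {a}     {suc p} 1+p≤a = +-monoʳ-≤ 1ℚ (++⁺-≼ S X≼Y (ℕ.<⇒≤ 1+p≤a))
++⁺-≼ (d ∷ S) X≼Y {zero}  {zero}  _     = ≤-refl
++⁺-≼ (d ∷ S) {X} {Y} X≼Y {suc a} {p} p≤1+a = begin
  E (suc a) p (d ∷ S ++ X)              ≡⟨ E-d a p (S ++ X) ⟩
  deletion a p (λ q → E a q (S ++ X))   ≤⟨ deletion-mono a p (λ q → ++⁺-≼ S X≼Y {a} {q}) p≤1+a ⟩
  deletion a p (λ q → E a q (S ++ Y))   ≡⟨ E-d a p (S ++ Y) ⟨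
  E (suc a) p (d ∷ S ++ Y)              ∎
  where open ≤-Reasoning

lemma6 : (a p : ℕ) (S₁ S₂ : Strategy) → p ≤ a →
    Feasible a (S₁ ++ (t ∷ d ∷ S₂)) →
    Feasible a (S₁ ++ (d ∷ t ∷ S₂)) →
    E a p (S₁ ++ (d ∷ t ∷ S₂)) ≤ℚ E a p (S₁ ++ (t ∷ d ∷ S₂))
lemma6 a p S₁ S₂ p≤a _ _ = ++⁺-≼ S₁ (dt≼td S₂) p≤a
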